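{- Let $\mathbf{U}=(\mathbf{T},G,H)$ be an $\mathrm{itKI}_{c1}$-algebra and let $S$ be a tense 1-filter of $\mathrm{C}(\mathbf{U})$. Then $$\theta_S=\{(u,v)\in T^2:\ u\Rightarrow(v\vee c),\ v\Rightarrow(u\vee c),\ \sim u\Rightarrow(\sim v\vee c),\ \sim v\Rightarrow(\sim u\vee c)\in S\}$$ is a congruence of $\mathbf{U}$.
   Context: A centered Kleene algebra is $\langle T,\wedge,\vee,\sim,c,0,1\rangle$ with bounded distributive lattice reduct, $\sim\sim x=x$, $\sim(x\vee y)=\sim x\wedge\sim y$, $x\wedge\sim x\le y\vee\sim y$, $\sim c=c$. A KI-algebra is $\langle T,\wedge,\vee,\Rightarrow,\sim,c,0,1\rangle$ with centered Kleene reduct such that: $(a\Rightarrow b)\wedge(a\Rightarrow d)=a\Rightarrow(b\wedge d)$, $(a\Rightarrow d)\wedge(b\Rightarrow d)=(a\vee b)\Rightarrow d$, $0\Rightarrow a=1$, $a\Rightarrow 1=1$; $(x\wedge(x\Rightarrow y))\vee c\le y\vee c$; $c\Rightarrow c=1$; $(x\Rightarrow y)\wedge c=(\sim x\vee y)\wedge c$; $(x\Rightarrow\sim y)\vee c=(x\Rightarrow(\sim y\vee c))\wedge(y\Rightarrow(\sim x\vee c))$. A tense centered KI-algebra is $(\mathbf{T},G,H)$ with $F(x):=\sim G(\sim x)$, $P(x):=\sim H(\sim x)$, satisfying $G(1)=H(1)=1$; $G,H$ preserve $\wedge$; $x\le GP(x)$, $x\le HF(x)$; $G(x\vee y)\le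 G(x)\vee F(y)$, $H(x\vee y)\le H(x)\vee P(y)$; $G(x\Rightarrow y)\le G(x)\Rightarrow G(y)$, $H(x\Rightarrow y)\le H(x)\Rightarrow H(y)$; $G(x\Rightarrow y)\le F(x)\Rightarrow F(y)$, $H(x\Rightarrow y)\le P(x)\Rightarrow P(y)$; $G(c)=c=H(c)$. An $\mathrm{itKI}_{c1}$-algebra is a tense centered KI-algebra satisfying $x\Rightarrow x=1$ and (CK): for all $x,y\ge c$ with $x\wedge y\le c$ there is $z$ with $z\vee c=x$ and $\sim z\vee c=y$. Congruences are compatible with $\wedge,\vee,\Rightarrow,\sim,c,0,1,G,H$. $\mathrm{C}(\mathbf{U})$ is $C(T)=\{x\in T:x\ge c\}$ with $\wedge,\vee,\Rightarrow,G,H,F,P$ restricted. A tense 1-filter of $\mathrm{C}(\mathbf{U})$ is a lattice filter $S$ of $C(T)$ with $((a\wedge f)\Rightarrow b)\Rightarrow(a\Rightarrow b)\in S$ for all $a,b\in C(T)$, $f\in S$, closed under $G$ and $H$. -}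

module Defs where

open import Level using (Level; suc; _⊔_)
open import Data.Product using (Σ; _×_; ∃)
open import Relation.Binary.PropositionalEquality using (_≡_)

record ItKIc1 (a : Level) : Set (suc a) where
  infixr 6 _∨_
  infixr 7 _∧_
  infixr 5 _⇒_
  infix 4 _≤_
  field
    T   : Set a
    _∧_ : T → T → T
    _∨_ : T → T → T
    _⇒_ : T → T → T
    ∼   : T → T
    c   : T
    𝟘   : T
    𝟙   : T
    G   : T → T
    H   : T → T

  _≤_ : T → T → Set a
  x ≤ y = x ∧ y ≡ x

  F : T → T
  F x = ∼ (G (∼ x))

  P : T → T
  P x = ∼ (H (∼ x))

  field
    ∧-assoc : ∀ x y z → (x ∧ y) ∧ z ≡ x ∧ (y ∧ z)
    ∨-assoc : ∀ x y z → (x ∨ y) ∨ z ≡ x ∨ (y ∨ z)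
    ∧-comm  : ∀ x y → x ∧ y ≡ y ∧ x
    ∨-comm  : ∀ x y → x ∨ y ≡ y ∨ x
    ∧-absorbs-∨ : ∀ x y → x ∧ (x ∨ y) ≡ x
    ∨-absorbs-∧ : ∀ x y → x ∨ (x ∧ y) ≡ x
    ∧-distrib-∨ : ∀ x y z → x ∧ (y ∨ z) ≡ (x ∧ y) ∨ (x ∧ z)
    ∨-identity : ∀ x → x ∨ 𝟘 ≡ x
    ∧-identity : ∀ x → x ∧ 𝟙 ≡ x
    ∼-invol   : ∀ x → ∼ (∼ x) ≡ x
    ∼-deMorgan : ∀ x y → ∼ (x ∨ y) ≡ ∼ x ∧ ∼ y
    kleene    : ∀ x y → x ∧ ∼ x ≤ y ∨ ∼ y
    ∼c        : ∼ c ≡ c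
    ⇒-∧ʳ : ∀ a b d → (a ⇒ b) ∧ (a ⇒ d) ≡ a ⇒ (b ∧ d)
    ⇒-∨ˡ : ∀ a b d → (a ⇒ d) ∧ (b ⇒ d) ≡ (a ∨ b) ⇒ d
    𝟘⇒   : ∀ a → 𝟘 ⇒ a ≡ 𝟙
    ⇒𝟙   : ∀ a → a ⇒ 𝟙 ≡ 𝟙
    mp   : ∀ x y → (x ∧ (x ⇒ y)) ∨ c ≤ y ∨ c
    c⇒c  : c ⇒ c ≡ 𝟙
    ⇒∧c  : ∀ x y → (x ⇒ y) ∧ c ≡ (∼ x ∨ y) ∧ c
    ⇒∼∨c : ∀ x y → (x ⇒ ∼ y) ∨ c ≡ (x ⇒ (∼ y ∨ c)) ∧ (y ⇒ (∼ x ∨ c))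
    G𝟙 : G 𝟙 ≡ 𝟙
    H𝟙 : H 𝟙 ≡ 𝟙
    G-∧ : ∀ x y → G (x ∧ y) ≡ G x ∧ G y
    H-∧ : ∀ x y → H (x ∧ y) ≡ H x ∧ H y
    x≤GPx : ∀ x → x ≤ G (P x)
    x≤HFx : ∀ x → x ≤ H (F x)
    G-∨ : ∀ x y → G (x ∨ y) ≤ G x ∨ F y
    H-∨ : ∀ x y → H (x ∨ y) ≤ H x ∨ P y
    G-⇒ : ∀ x y → G (x ⇒ y) ≤ G x ⇒ G y
    H-⇒ : ∀ x y → H (x ⇒ y) ≤ H x ⇒ H y
    G-⇒F : ∀ x y → G (x ⇒ y) ≤ F x ⇒ F y
    H-⇒P : ∀ x y → H (x ⇒ y) ≤ P x ⇒ P y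
    Gc : G c ≡ c
    Hc : H c ≡ c
    ⇒-refl : ∀ x → x ⇒ x ≡ 𝟙
    CK : ∀ x y → c ≤ x → c ≤ y → x ∧ y ≤ c →
         Σ T (λ z → (z ∨ c ≡ x) × (∼ z ∨ c ≡ y))

module _ {a : Level} (U : ItKIc1 a) where
  open ItKIc1 U

  -- A tense 1-filter of C(U), given as a predicate S on T whose members lie in C(T).
  record Tense1Filter {ℓ : Level} (S : T → Set ℓ) : Set (a ⊔ ℓ) where
    field
      ⊆C       : ∀ {x} → S x → c ≤ x
      nonempty : ∃ S
      up-closed : ∀ {x y} → S x → c ≤ y → x ≤ y → S y
      ∧-closed : ∀ {x y} → S x → S y → S (x ∧ y)
      one-cond : ∀ a' b f → c ≤ a' → c ≤ b → S f →
                 S (((a' ∧ f) ⇒ b) ⇒ (a' ⇒ b))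
      G-closed : ∀ {x} → S x → S (G x)
      H-closed : ∀ {x} → S x → S (H x)

  θ : {ℓ : Level} → (T → Set ℓ) → T → T → Set ℓ
  θ S u v = S (u ⇒ (v ∨ c)) × S (v ⇒ (u ∨ c))
          × S (∼ u ⇒ (∼ v ∨ c)) × S (∼ v ⇒ (∼ u ∨ c))

  -- congruence of U: equivalence relation compatible with ∧, ∨, ⇒, ∼, G, H
  -- (compatibility with the constants c, 0, 1 is reflexivity)
  record IsCongruence {ℓ : Level} (R : T → T → Set ℓ) : Set (a ⊔ ℓ) where
    field
      refl′  : ∀ x → R x x
      sym′   : ∀ {x y} → R x y → R y x
      trans′ : ∀ {x y z} → R x y → R y z → R x z
      ∧-cong : ∀ {x y u v} → R x y → R u v → R (x ∧ u) (y ∧ v)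
      ∨-cong : ∀ {x y u v} → R x y → R u v → R (x ∨ u) (y ∨ v)
      ⇒-cong : ∀ {x y u v} → R x y → R u v → R (x ⇒ u) (y ⇒ v)
      ∼-cong : ∀ {x y} → R x y → R (∼ x) (∼ y)
      G-cong : ∀ {x y} → R x y → R (G x) (G y)
      H-cong : ∀ {x y} → R x y → R (H x) (H y)

{-# OPTIONS --safe #-}
-- A tense 1-filter S induces on C(U) the relation x ≋ y :⇔ x ⇒ y, y ⇒ x ∈ S.
-- The 1-condition acts as a local deduction theorem (from f ∈ S and
-- (x ∧ f) ⇒ y ∈ S infer x ⇒ y ∈ S), which makes ≋ transitive and compatible
-- with ⇒; compatibility with ∧, ∨ and the tense operators is direct.
-- Writing x̂ = ⌈ x ⌉ = x ∨ c and x̌ = ⌈ ∼ x ⌉, the identity u ⇒ v̂ = û ⇒ v̂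
-- shows that (u, v) ∈ θ_S iff û ≋ v̂ and ǔ ≋ v̌.  For each operation the hat
-- and check of its value are C(U)-operations applied to the hats and checks
-- of its arguments, e.g. (x ⇒ u)^ = (x̂ ⇒ û) ∧ (ǔ ⇒ x̌) and (x ⇒ u)ˇ = x̂ ∧ ǔ,
-- so θ_S inherits each compatibility property from ≋.
module Submission where

open import Level using (Level; _⊔_)
open import Function using (_∘_)
open import Data.Product using (_×_; _,_)
open import Relation.Binary.PropositionalEquality
open import Algebra.Consequences.Propositional
  using (comm∧distrˡ⇒distrʳ; comm∧assoc⇒middleFour)
open import Algebra.Lattice.Bundles using (Lattice; DistributiveLattice)
import Algebra.Lattice.Properties.Lattice as LatticeProperties
import Algebra.Lattice.Properties.DistributiveLattice as DistributiveLatticeProperties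
import Algebra.Lattice.Structures.Biased as Biased
import Relation.Binary.Lattice as OrderTheoretic
open import Defs

module KIAlgebra {a : Level} (U : ItKIc1 a) where
  open ItKIc1 U
  open ≡-Reasoning

  lattice : Lattice a a
  lattice = record
    { isLattice = record
      { isEquivalence = isEquivalence
      ; ∨-comm        = ∨-comm
      ; ∨-assoc       = ∨-assoc
      ; ∨-cong        = cong₂ _∨_
      ; ∧-comm        = ∧-comm
      ; ∧-assoc       = ∧-assoc
      ; ∧-cong        = cong₂ _∧_
      ; absorptive    = ∨-absorbs-∧ , ∧-absorbs-∨
      }
    }

  open LatticeProperties lattice using (∨-idem; ∧-∨-isLattice; ∨-∧-orderTheoreticLattice)

  -- Only ∧ over ∨ is an axiom; the library derives the dual law.
  distributiveLattice : DistributiveLattice a a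
  distributiveLattice = DistributiveLatticeProperties.∧-∨-distributiveLattice record
    { isDistributiveLattice = Biased.isDistributiveLatticeʳʲᵐ record
      { isLattice    = ∧-∨-isLattice
      ; ∨-distribʳ-∧ = comm∧distrˡ⇒distrʳ ∧-comm ∧-distrib-∨
      }
    }

  open DistributiveLattice distributiveLattice using (∨-distribʳ-∧)

  -- The library orders by x ≡ x ∧ y, the algebra by x ∧ y ≡ x.
  private module Ord = OrderTheoretic.Lattice ∨-∧-orderTheoreticLattice

  ≤-trans : ∀ {x y z} → x ≤ y → y ≤ z → x ≤ z
  ≤-trans p q = sym (Ord.trans (sym p) (sym q))

  ≤-antisym : ∀ {x y} → x ≤ y → y ≤ x → x ≡ y
  ≤-antisym p q = Ord.antisym (sym p) (sym q)

  x∧y≤x : ∀ x y → x ∧ y ≤ x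
  x∧y≤x x y = sym (Ord.x∧y≤x x y)

  x∧y≤y : ∀ x y → x ∧ y ≤ y
  x∧y≤y x y = sym (Ord.x∧y≤y x y)

  ∧-greatest : ∀ {x y z} → x ≤ y → x ≤ z → x ≤ y ∧ z
  ∧-greatest p q = sym (Ord.∧-greatest (sym p) (sym q))

  x≤x∨y : ∀ x y → x ≤ x ∨ y
  x≤x∨y x y = sym (Ord.x≤x∨y x y)

  y≤x∨y : ∀ x y → y ≤ x ∨ y
  y≤x∨y x y = sym (Ord.y≤x∨y x y)

  ∨-least : ∀ {x y z} → x ≤ z → y ≤ z → x ∨ y ≤ z
  ∨-least p q = sym (Ord.∨-least (sym p) (sym q))

  x≤𝟙 : ∀ x → x ≤ 𝟙
  x≤𝟙 = ∧-identity

  ≤⇒∨≡ : ∀ {x y} → x ≤ y → x ∨ y ≡ y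
  ≤⇒∨≡ {x} {y} p = begin
    x ∨ y        ≡⟨ cong (_∨ y) (sym p) ⟩
    (x ∧ y) ∨ y  ≡⟨ ∨-comm _ y ⟩
    y ∨ (x ∧ y)  ≡⟨ cong (y ∨_) (∧-comm x y) ⟩
    y ∨ (y ∧ x)  ≡⟨ ∨-absorbs-∧ y x ⟩
    y            ∎

  ∼-antitone : ∀ {x y} → x ≤ y → ∼ y ≤ ∼ x
  ∼-antitone {x} {y} p =
    trans (∧-comm (∼ y) (∼ x)) (trans (sym (∼-deMorgan x y)) (cong ∼ (≤⇒∨≡ p)))

  ∼-deMorgan-∧ : ∀ x y → ∼ (x ∧ y) ≡ ∼ x ∨ ∼ y
  ∼-deMorgan-∧ x y = begin
    ∼ (x ∧ y)              ≡⟨ cong ∼ (cong₂ _∧_ (sym (∼-invol x)) (sym (∼-invol y))) ⟩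
    ∼ (∼ (∼ x) ∧ ∼ (∼ y))  ≡⟨ cong ∼ (sym (∼-deMorgan (∼ x) (∼ y))) ⟩
    ∼ (∼ (∼ x ∨ ∼ y))      ≡⟨ ∼-invol _ ⟩
    ∼ x ∨ ∼ y              ∎

  ⇒-monotoneʳ : ∀ {x y z} → y ≤ z → x ⇒ y ≤ x ⇒ z
  ⇒-monotoneʳ {x} {y} {z} p = trans (⇒-∧ʳ x y z) (cong (x ⇒_) p)

  ⇒-antitoneˡ : ∀ {x y z} → x ≤ y → y ⇒ z ≤ x ⇒ z
  ⇒-antitoneˡ {x} {y} {z} p =
    trans (∧-comm _ _) (trans (⇒-∨ˡ x y z) (cong (_⇒ z) (≤⇒∨≡ p)))

  ⇒≡𝟙 : ∀ {x y} → x ≤ y → x ⇒ y ≡ 𝟙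
  ⇒≡𝟙 {x} {y} p =
    ≤-antisym (x≤𝟙 _) (subst (_≤ x ⇒ y) (⇒-refl x) (⇒-monotoneʳ p))

  ⇒-centred : ∀ {x y} → c ≤ y → c ≤ x ⇒ y
  ⇒-centred {x} {y} p = begin
    c ∧ (x ⇒ y)    ≡⟨ ∧-comm c _ ⟩
    (x ⇒ y) ∧ c    ≡⟨ ⇒∧c x y ⟩
    (∼ x ∨ y) ∧ c  ≡⟨ ∧-comm _ c ⟩
    c ∧ (∼ x ∨ y)  ≡⟨ ≤-trans p (y≤x∨y (∼ x) y) ⟩
    c              ∎

  ⌈_⌉ : T → T
  ⌈ x ⌉ = x ∨ c

  c≤⌈⌉ : ∀ x → c ≤ ⌈ x ⌉
  c≤⌈⌉ x = y≤x∨y x c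

  ⌈⌉-centred : ∀ {x} → c ≤ x → ⌈ x ⌉ ≡ x
  ⌈⌉-centred {x} p = trans (∨-comm x c) (≤⇒∨≡ p)

  x∧[x⇒y]≤y : ∀ {x y} → c ≤ x → c ≤ y → x ∧ (x ⇒ y) ≤ y
  x∧[x⇒y]≤y {x} {y} c≤x c≤y = begin
    (x ∧ (x ⇒ y)) ∧ y              ≡⟨ cong₂ _∧_ (sym (⌈⌉-centred c≤m)) (sym (⌈⌉-centred c≤y)) ⟩
    ⌈ x ∧ (x ⇒ y) ⌉ ∧ ⌈ y ⌉        ≡⟨ mp x y ⟩
    ⌈ x ∧ (x ⇒ y) ⌉                ≡⟨ ⌈⌉-centred c≤m ⟩
    x ∧ (x ⇒ y)                    ∎
    where c≤m = ∧-greatest c≤x (⇒-centred c≤y)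

  x⇒y≤[x∧[y⇒z]]⇒z : ∀ {x y z} → c ≤ y → c ≤ z → x ⇒ y ≤ (x ∧ (y ⇒ z)) ⇒ z
  x⇒y≤[x∧[y⇒z]]⇒z {x} {y} {z} c≤y c≤z =
    ≤-trans (⇒-antitoneˡ (x∧y≤x x f)) (subst (_≤ g ⇒ z) weaken (⇒-monotoneʳ (x∧[x⇒y]≤y c≤y c≤z)))
    where
    f = y ⇒ z
    g = x ∧ f
    weaken : g ⇒ (y ∧ f) ≡ g ⇒ y
    weaken = begin
      g ⇒ (y ∧ f)        ≡⟨ sym (⇒-∧ʳ g y f) ⟩
      (g ⇒ y) ∧ (g ⇒ f)  ≡⟨ cong ((g ⇒ y) ∧_) (⇒≡𝟙 (x∧y≤y x f)) ⟩
      (g ⇒ y) ∧ 𝟙        ≡⟨ ∧-identity _ ⟩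
      g ⇒ y              ∎

  ∼⌈∼⌉ : ∀ x → ∼ ⌈ ∼ x ⌉ ≡ x ∧ c
  ∼⌈∼⌉ x = trans (∼-deMorgan (∼ x) c) (cong₂ _∧_ (∼-invol x) ∼c)

  ⇒⌈⌉ : ∀ x y → x ⇒ ⌈ y ⌉ ≡ ⌈ x ⌉ ⇒ ⌈ y ⌉
  ⇒⌈⌉ x y = begin
    x ⇒ ⌈ y ⌉                      ≡⟨ sym (∧-identity _) ⟩
    (x ⇒ ⌈ y ⌉) ∧ 𝟙                ≡⟨ cong ((x ⇒ ⌈ y ⌉) ∧_) (sym (⇒≡𝟙 (c≤⌈⌉ y))) ⟩
    (x ⇒ ⌈ y ⌉) ∧ (c ⇒ ⌈ y ⌉)      ≡⟨ ⇒-∨ˡ x c ⌈ y ⌉ ⟩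
    ⌈ x ⌉ ⇒ ⌈ y ⌉                  ∎

  ⌈∧⌉ : ∀ x y → ⌈ x ∧ y ⌉ ≡ ⌈ x ⌉ ∧ ⌈ y ⌉
  ⌈∧⌉ x y = ∨-distribʳ-∧ c x y

  ⌈∨⌉ : ∀ x y → ⌈ x ∨ y ⌉ ≡ ⌈ x ⌉ ∨ ⌈ y ⌉
  ⌈∨⌉ x y =
    trans (cong ((x ∨ y) ∨_) (sym (∨-idem c))) (comm∧assoc⇒middleFour ∨-comm ∨-assoc x y c c)

  ⌈∼∧⌉ : ∀ x y → ⌈ ∼ (x ∧ y) ⌉ ≡ ⌈ ∼ x ⌉ ∨ ⌈ ∼ y ⌉
  ⌈∼∧⌉ x y = trans (cong ⌈_⌉ (∼-deMorgan-∧ x y)) (⌈∨⌉ (∼ x) (∼ y))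

  ⌈∼∨⌉ : ∀ x y → ⌈ ∼ (x ∨ y) ⌉ ≡ ⌈ ∼ x ⌉ ∧ ⌈ ∼ y ⌉
  ⌈∼∨⌉ x y = trans (cong ⌈_⌉ (∼-deMorgan x y)) (⌈∧⌉ (∼ x) (∼ y))

  ⌈⇒⌉ : ∀ x y → ⌈ x ⇒ y ⌉ ≡ (⌈ x ⌉ ⇒ ⌈ y ⌉) ∧ (⌈ ∼ y ⌉ ⇒ ⌈ ∼ x ⌉)
  ⌈⇒⌉ x y = begin
    ⌈ x ⇒ y ⌉                              ≡⟨ cong (λ t → ⌈ x ⇒ t ⌉) (sym (∼-invol y)) ⟩
    ⌈ x ⇒ ∼ (∼ y) ⌉                        ≡⟨ ⇒∼∨c x (∼ y) ⟩
    (x ⇒ ⌈ ∼ (∼ y) ⌉) ∧ (∼ y ⇒ ⌈ ∼ x ⌉)    ≡⟨ cong (λ t → (x ⇒ ⌈ t ⌉) ∧ (∼ y ⇒ ⌈ ∼ x ⌉)) (∼-invol y) ⟩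
    (x ⇒ ⌈ y ⌉) ∧ (∼ y ⇒ ⌈ ∼ x ⌉)          ≡⟨ cong₂ _∧_ (⇒⌈⌉ x y) (⇒⌈⌉ (∼ y) (∼ x)) ⟩
    (⌈ x ⌉ ⇒ ⌈ y ⌉) ∧ (⌈ ∼ y ⌉ ⇒ ⌈ ∼ x ⌉)  ∎

  ⌈∼⇒⌉ : ∀ x y → ⌈ ∼ (x ⇒ y) ⌉ ≡ ⌈ x ⌉ ∧ ⌈ ∼ y ⌉
  ⌈∼⇒⌉ x y = begin
    ⌈ ∼ (x ⇒ y) ⌉            ≡⟨ sym (∼-invol _) ⟩
    ∼ (∼ ⌈ ∼ (x ⇒ y) ⌉)      ≡⟨ cong ∼ (∼⌈∼⌉ (x ⇒ y)) ⟩
    ∼ ((x ⇒ y) ∧ c)          ≡⟨ cong ∼ (⇒∧c x y) ⟩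
    ∼ ((∼ x ∨ y) ∧ c)        ≡⟨ ∼-deMorgan-∧ _ c ⟩
    ∼ (∼ x ∨ y) ∨ ∼ c        ≡⟨ cong₂ _∨_ (∼-deMorgan (∼ x) y) ∼c ⟩
    ⌈ ∼ (∼ x) ∧ ∼ y ⌉        ≡⟨ cong (λ t → ⌈ t ∧ ∼ y ⌉) (∼-invol x) ⟩
    ⌈ x ∧ ∼ y ⌉              ≡⟨ ⌈∧⌉ x (∼ y) ⟩
    ⌈ x ⌉ ∧ ⌈ ∼ y ⌉          ∎

  module TenseOperator
    (O   : T → T)
    (O-∧ : ∀ x y → O (x ∧ y) ≡ O x ∧ O y)
    (O-c : O c ≡ c)
    (O-∨ : ∀ x y → O (x ∨ y) ≤ O x ∨ ∼ (O (∼ y)))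
    where

    dual : T → T
    dual x = ∼ (O (∼ x))

    monotone : ∀ {x y} → x ≤ y → O x ≤ O y
    monotone {x} {y} p = trans (sym (O-∧ x y)) (cong O p)

    dual-monotone : ∀ {x y} → x ≤ y → dual x ≤ dual y
    dual-monotone = ∼-antitone ∘ monotone ∘ ∼-antitone

    dual-c : dual c ≡ c
    dual-c = trans (cong (∼ ∘ O) ∼c) (trans (cong ∼ O-c) ∼c)

    centred : ∀ {x} → c ≤ x → c ≤ O x
    centred {x} p = subst (_≤ O x) O-c (monotone p)

    dual-centred : ∀ {x} → c ≤ x → c ≤ dual x
    dual-centred {x} p = subst (_≤ dual x) dual-c (dual-monotone p)

    ⌈O⌉ : ∀ x → ⌈ O x ⌉ ≡ O ⌈ x ⌉
    ⌈O⌉ x = ≤-antisym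
      (∨-least (monotone (x≤x∨y x c)) (centred (c≤⌈⌉ x)))
      (subst (λ t → O ⌈ x ⌉ ≤ O x ∨ t) dual-c (O-∨ x c))

    ⌈∼O⌉ : ∀ x → ⌈ ∼ (O x) ⌉ ≡ dual ⌈ ∼ x ⌉
    ⌈∼O⌉ x = begin
      ⌈ ∼ (O x) ⌉          ≡⟨ sym (∼-invol _) ⟩
      ∼ (∼ ⌈ ∼ (O x) ⌉)    ≡⟨ cong ∼ (∼⌈∼⌉ (O x)) ⟩
      ∼ (O x ∧ c)          ≡⟨ cong (λ t → ∼ (O x ∧ t)) (sym O-c) ⟩
      ∼ (O x ∧ O c)        ≡⟨ cong ∼ (sym (O-∧ x c)) ⟩
      ∼ (O (x ∧ c))        ≡⟨ cong (∼ ∘ O) (sym (∼⌈∼⌉ x)) ⟩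
      dual ⌈ ∼ x ⌉         ∎

  open TenseOperator G G-∧ Gc G-∨ public
    using () renaming (centred to G-centred; dual-centred to F-centred; ⌈O⌉ to ⌈G⌉; ⌈∼O⌉ to ⌈∼G⌉)
  open TenseOperator H H-∧ Hc H-∨ public
    using () renaming (centred to H-centred; dual-centred to P-centred; ⌈O⌉ to ⌈H⌉; ⌈∼O⌉ to ⌈∼H⌉)

module FilterEquivalence
  {a ℓ : Level} (U : ItKIc1 a) (S : ItKIc1.T U → Set ℓ) (filter : Tense1Filter U S) where
  open ItKIc1 U
  open KIAlgebra U
  open Tense1Filter filter

  infix 4 _⊑_ _≋_

  _⊑_ : T → T → Set ℓ
  x ⊑ y = S (x ⇒ y)

  𝟙∈S : S 𝟙
  𝟙∈S = let (f , f∈S) = nonempty in up-closed f∈S (x≤𝟙 c) (x≤𝟙 f)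

  modus-ponens : ∀ {x y} → S x → x ⊑ y → c ≤ y → S y
  modus-ponens x∈S x⊑y c≤y = up-closed (∧-closed x∈S x⊑y) c≤y (x∧[x⇒y]≤y (⊆C x∈S) c≤y)

  ⊑-refl : ∀ {x} → x ⊑ x
  ⊑-refl {x} = subst S (sym (⇒-refl x)) 𝟙∈S

  ≤-⊑-trans : ∀ {x y z} → c ≤ z → x ≤ y → y ⊑ z → x ⊑ z
  ≤-⊑-trans c≤z x≤y y⊑z = up-closed y⊑z (⇒-centred c≤z) (⇒-antitoneˡ x≤y)

  ⊑-≤-trans : ∀ {x y z} → c ≤ z → x ⊑ y → y ≤ z → x ⊑ z
  ⊑-≤-trans c≤z x⊑y y≤z = up-closed x⊑y (⇒-centred c≤z) (⇒-monotoneʳ y≤z)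

  ⊑-∧-greatest : ∀ {x y z} → x ⊑ y → x ⊑ z → x ⊑ y ∧ z
  ⊑-∧-greatest {x} {y} {z} p q = subst S (⇒-∧ʳ x y z) (∧-closed p q)

  ⊑-∨-least : ∀ {x y z} → x ⊑ z → y ⊑ z → x ∨ y ⊑ z
  ⊑-∨-least {x} {y} {z} p q = subst S (⇒-∨ˡ x y z) (∧-closed p q)

  deduction : ∀ {x y f} → c ≤ x → c ≤ y → S f → x ∧ f ⊑ y → x ⊑ y
  deduction {x} {y} {f} c≤x c≤y f∈S p = modus-ponens p (one-cond x y f c≤x c≤y f∈S) (⇒-centred c≤y)

  ⊑-trans : ∀ {x y z} → c ≤ x → c ≤ y → c ≤ z → x ⊑ y → y ⊑ z → x ⊑ z
  ⊑-trans c≤x c≤y c≤z x⊑y y⊑z =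
    deduction c≤x c≤z x⊑y (≤-⊑-trans c≤z (x∧[x⇒y]≤y c≤x c≤y) y⊑z)

  ∧-monotone-⊑ : ∀ {x y x′ y′} → c ≤ x′ → c ≤ y′ → x ⊑ x′ → y ⊑ y′ → x ∧ y ⊑ x′ ∧ y′
  ∧-monotone-⊑ {x} {y} c≤x′ c≤y′ p q =
    ⊑-∧-greatest (≤-⊑-trans c≤x′ (x∧y≤x x y) p) (≤-⊑-trans c≤y′ (x∧y≤y x y) q)

  ∨-monotone-⊑ : ∀ {x y x′ y′} → c ≤ x′ → x ⊑ x′ → y ⊑ y′ → x ∨ y ⊑ x′ ∨ y′
  ∨-monotone-⊑ {x′ = x′} {y′} c≤x′ p q =
    ⊑-∨-least (⊑-≤-trans c≤x′∨y′ p (x≤x∨y x′ y′)) (⊑-≤-trans c≤x′∨y′ q (y≤x∨y x′ y′))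
    where c≤x′∨y′ = ≤-trans c≤x′ (x≤x∨y x′ y′)

  -- Both halves pass through an implication (x ∧ f) ⇒ y with f ∈ S and then
  -- drop f by the 1-condition.
  ⇒-antitoneˡ-⊑ : ∀ {x x′ y} → c ≤ x → c ≤ x′ → c ≤ y → x′ ⊑ x → x ⇒ y ⊑ x′ ⇒ y
  ⇒-antitoneˡ-⊑ {x′ = x′} {y} c≤x c≤x′ c≤y x′⊑x =
    ≤-⊑-trans (⇒-centred c≤y) (⇒-antitoneˡ (x∧[x⇒y]≤y c≤x′ c≤x)) (one-cond x′ y _ c≤x′ c≤y x′⊑x)

  ⇒-monotoneʳ-⊑ : ∀ {x y y′} → c ≤ x → c ≤ y → c ≤ y′ → y ⊑ y′ → x ⇒ y ⊑ x ⇒ y′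
  ⇒-monotoneʳ-⊑ {x} {y′ = y′} c≤x c≤y c≤y′ y⊑y′ =
    ≤-⊑-trans (⇒-centred c≤y′) (x⇒y≤[x∧[y⇒z]]⇒z c≤y c≤y′) (one-cond x y′ _ c≤x c≤y′ y⊑y′)

  ⇒-monotone-⊑ : ∀ {x x′ y y′} → c ≤ x → c ≤ x′ → c ≤ y → c ≤ y′ →
                 x′ ⊑ x → y ⊑ y′ → x ⇒ y ⊑ x′ ⇒ y′
  ⇒-monotone-⊑ c≤x c≤x′ c≤y c≤y′ x′⊑x y⊑y′ =
    ⊑-trans (⇒-centred c≤y) (⇒-centred c≤y) (⇒-centred c≤y′)
      (⇒-antitoneˡ-⊑ c≤x c≤x′ c≤y x′⊑x) (⇒-monotoneʳ-⊑ c≤x′ c≤y c≤y′ y⊑y′)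

  record _≋_ (x y : T) : Set (a ⊔ ℓ) where
    constructor mk≋
    field
      centredˡ : c ≤ x
      centredʳ : c ≤ y
      forth    : x ⊑ y
      back     : y ⊑ x

  ≋-refl : ∀ {x} → c ≤ x → x ≋ x
  ≋-refl c≤x = mk≋ c≤x c≤x ⊑-refl ⊑-refl

  ≋-sym : ∀ {x y} → x ≋ y → y ≋ x
  ≋-sym (mk≋ c≤x c≤y p q) = mk≋ c≤y c≤x q p

  ≋-trans : ∀ {x y z} → x ≋ y → y ≋ z → x ≋ z
  ≋-trans (mk≋ c≤x c≤y p q) (mk≋ _ c≤z p′ q′) =
    mk≋ c≤x c≤z (⊑-trans c≤x c≤y c≤z p p′) (⊑-trans c≤z c≤y c≤x q′ q)

  ≋-resp-≡ : ∀ {x x′ y y′} → x ≡ x′ → y ≡ y′ → x′ ≋ y′ → x ≋ y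
  ≋-resp-≡ refl refl p = p

  ∧-cong-≋ : ∀ {x y u v} → x ≋ y → u ≋ v → x ∧ u ≋ y ∧ v
  ∧-cong-≋ (mk≋ c≤x c≤y p q) (mk≋ c≤u c≤v p′ q′) =
    mk≋ (∧-greatest c≤x c≤u) (∧-greatest c≤y c≤v)
        (∧-monotone-⊑ c≤y c≤v p p′) (∧-monotone-⊑ c≤x c≤u q q′)

  ∨-cong-≋ : ∀ {x y u v} → x ≋ y → u ≋ v → x ∨ u ≋ y ∨ v
  ∨-cong-≋ {x} {y} {u} {v} (mk≋ c≤x c≤y p q) (mk≋ _ _ p′ q′) =
    mk≋ (≤-trans c≤x (x≤x∨y x u)) (≤-trans c≤y (x≤x∨y y v))
        (∨-monotone-⊑ c≤y p p′) (∨-monotone-⊑ c≤x q q′)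

  ⇒-cong-≋ : ∀ {x y u v} → x ≋ y → u ≋ v → x ⇒ u ≋ y ⇒ v
  ⇒-cong-≋ (mk≋ c≤x c≤y p q) (mk≋ c≤u c≤v p′ q′) =
    mk≋ (⇒-centred c≤u) (⇒-centred c≤v)
        (⇒-monotone-⊑ c≤x c≤y c≤u c≤v q p′) (⇒-monotone-⊑ c≤y c≤x c≤v c≤u p q′)

  ≋-image : {O Q : T → T} → (∀ {x} → S x → S (O x)) →
            (∀ x y → O (x ⇒ y) ≤ Q x ⇒ Q y) → (∀ {x} → c ≤ x → c ≤ Q x) →
            ∀ {x y} → x ≋ y → Q x ≋ Q y
  ≋-image {Q = Q} O-closed O-⇒ Q-centred (mk≋ c≤x c≤y p q) =
    mk≋ (Q-centred c≤x) (Q-centred c≤y) (image c≤y p) (image c≤x q)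
    where
    image : ∀ {x y} → c ≤ y → x ⊑ y → Q x ⊑ Q y
    image {x} {y} c≤y x⊑y = up-closed (O-closed x⊑y) (⇒-centred (Q-centred c≤y)) (O-⇒ x y)

module ThetaCongruence
  {a ℓ : Level} (U : ItKIc1 a) (S : ItKIc1.T U → Set ℓ) (filter : Tense1Filter U S) where
  open ItKIc1 U
  open KIAlgebra U
  open Tense1Filter filter using (G-closed; H-closed)
  open FilterEquivalence U S filter

  θ̂ : T → T → Set (a ⊔ ℓ)
  θ̂ u v = ⌈ u ⌉ ≋ ⌈ v ⌉ × ⌈ ∼ u ⌉ ≋ ⌈ ∼ v ⌉

  θ⇒θ̂ : ∀ {u v} → θ U S u v → θ̂ u v
  θ⇒θ̂ {u} {v} (p , q , r , s) =
    mk≋ (c≤⌈⌉ u) (c≤⌈⌉ v) (subst S (⇒⌈⌉ u v) p) (subst S (⇒⌈⌉ v u) q) ,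
    mk≋ (c≤⌈⌉ (∼ u)) (c≤⌈⌉ (∼ v))
        (subst S (⇒⌈⌉ (∼ u) (∼ v)) r) (subst S (⇒⌈⌉ (∼ v) (∼ u)) s)

  θ̂⇒θ : ∀ {u v} → θ̂ u v → θ U S u v
  θ̂⇒θ {u} {v} (mk≋ _ _ p q , mk≋ _ _ r s) =
    subst S (sym (⇒⌈⌉ u v)) p , subst S (sym (⇒⌈⌉ v u)) q ,
    subst S (sym (⇒⌈⌉ (∼ u) (∼ v))) r , subst S (sym (⇒⌈⌉ (∼ v) (∼ u))) s

  θ̂-isCongruence : IsCongruence U θ̂
  θ̂-isCongruence = record
    { refl′  = λ x → ≋-refl (c≤⌈⌉ x) , ≋-refl (c≤⌈⌉ (∼ x))
    ; sym′   = λ (p , q) → ≋-sym p , ≋-sym q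
    ; trans′ = λ (p , q) (p′ , q′) → ≋-trans p p′ , ≋-trans q q′
    ; ∧-cong = λ {x} {y} {u} {v} (p , q) (p′ , q′) →
        ≋-resp-≡ (⌈∧⌉ x u) (⌈∧⌉ y v) (∧-cong-≋ p p′) ,
        ≋-resp-≡ (⌈∼∧⌉ x u) (⌈∼∧⌉ y v) (∨-cong-≋ q q′)
    ; ∨-cong = λ {x} {y} {u} {v} (p , q) (p′ , q′) →
        ≋-resp-≡ (⌈∨⌉ x u) (⌈∨⌉ y v) (∨-cong-≋ p p′) ,
        ≋-resp-≡ (⌈∼∨⌉ x u) (⌈∼∨⌉ y v) (∧-cong-≋ q q′)
    ; ⇒-cong = λ {x} {y} {u} {v} (p , q) (p′ , q′) →
        ≋-resp-≡ (⌈⇒⌉ x u) (⌈⇒⌉ y v) (∧-cong-≋ (⇒-cong-≋ p p′) (⇒-cong-≋ q′ q)) ,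
        ≋-resp-≡ (⌈∼⇒⌉ x u) (⌈∼⇒⌉ y v) (∧-cong-≋ p q′)
    ; ∼-cong = λ {x} {y} (p , q) →
        q , ≋-resp-≡ (cong ⌈_⌉ (∼-invol x)) (cong ⌈_⌉ (∼-invol y)) p
    ; G-cong = λ {x} {y} (p , q) →
        ≋-resp-≡ (⌈G⌉ x) (⌈G⌉ y) (≋-image G-closed G-⇒ G-centred p) ,
        ≋-resp-≡ (⌈∼G⌉ x) (⌈∼G⌉ y) (≋-image G-closed G-⇒F F-centred q)
    ; H-cong = λ {x} {y} (p , q) →
        ≋-resp-≡ (⌈H⌉ x) (⌈H⌉ y) (≋-image H-closed H-⇒ H-centred p) ,
        ≋-resp-≡ (⌈∼H⌉ x) (⌈∼H⌉ y) (≋-image H-closed H-⇒P P-centred q)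
    }

IsCongruence-⇔ : {a ℓ ℓ′ : Level} {U : ItKIc1 a} {R : ItKIc1.T U → ItKIc1.T U → Set ℓ}
                 {R′ : ItKIc1.T U → ItKIc1.T U → Set ℓ′} →
                 (∀ {x y} → R x y → R′ x y) → (∀ {x y} → R′ x y → R x y) →
                 IsCongruence U R → IsCongruence U R′
IsCongruence-⇔ to from isCongruence = record
  { refl′  = λ x → to (refl′ x)
  ; sym′   = λ p → to (sym′ (from p))
  ; trans′ = λ p q → to (trans′ (from p) (from q))
  ; ∧-cong = λ p q → to (∧-cong (from p) (from q))
  ; ∨-cong = λ p q → to (∨-cong (from p) (from q))
  ; ⇒-cong = λ p q → to (⇒-cong (from p) (from q))
  ; ∼-cong = λ p → to (∼-cong (from p))
  ; G-cong = λ p → to (G-cong (from p))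
  ; H-cong = λ p → to (H-cong (from p))
  }
  where open IsCongruence isCongruence

lemma7p5 : {a ℓ : Level} (U : ItKIc1 a) (S : ItKIc1.T U → Set ℓ) →
           Tense1Filter U S → IsCongruence U (θ U S)
lemma7p5 U S filter = IsCongruence-⇔ θ̂⇒θ θ⇒θ̂ θ̂-isCongruence
  where open ThetaCongruence U S filter
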